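{- Let $f_1,\dots,f_m$ be rational linear forms on $\mathbb{R}^d$ such that every variable appears in at least one form and the system $f_1(x)=\cdots=f_m(x)=1$ is consistent; let $s$ be its solution space, $P:=s\cap\mathbb{R}^d_{\ge0}$, and $\mathcal{H}:=\{h_{jk}\cap s : h_{jk}\not\supseteq s\}$ where $h_{jk}$ is the hyperplane $x_j=x_k$. If $s$ is not contained in any hyperplane $x_j=x_k$ and all forms $f_i$ have equal positive weight (i.e. $f_1(\mathbf 1)=\cdots=f_m(\mathbf 1)=c>0$ where $\mathbf 1=(1,\dots,1)$), then $P$ and $\mathcal{H}$ are transverse.
   Context: $P$ and $\mathcal{H}$ are transverse if $P$ lies in no hyperplane of $\mathcal{H}$ and every flat (nonempty intersection of hyperplanes of $\mathcal{H}$) that meets $P$ also meets the relative interior $P^\circ$.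
   Formalization: Points are taken in ℚ^d instead of ℝ^d, so the solution space s, the polyhedron P, the flats, affine hulls and the relative interior $P^\circ$ consist of rational points. -}

module Defs where

open import Data.Nat using (ℕ; zero; suc)
open import Data.Fin using (Fin; zero; suc)
open import Data.Rational using (ℚ; 0ℚ; 1ℚ; _+_; _*_; _-_; ∣_∣; _≤_; _<_)
open import Data.List using (List; []; _∷_; foldr; map)
open import Data.List.Relation.Unary.All using (All)
open import Data.List.Membership.Propositional using (_∈_)
open import Data.Product using (Σ; ∃; ∃-syntax; _×_; _,_; proj₁; proj₂)
open import Relation.Binary.PropositionalEquality using (_≡_; _≢_)
open import Relation.Nullary using (¬_)

Pt : ℕ → Set
Pt d = Fin d → ℚ

∑ : ∀ {n} → (Fin n → ℚ) → ℚ
∑ {zero} f = 0ℚ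
∑ {suc n} f = f zero + ∑ (λ i → f (suc i))

LinForm : ℕ → Set
LinForm d = Fin d → ℚ

eval : ∀ {d} → LinForm d → Pt d → ℚ
eval a x = ∑ (λ j → a j * x j)

ones : ∀ {d} → Pt d
ones _ = 1ℚ

Subset : ℕ → Set₁
Subset d = Pt d → Set

SolSpace : ∀ {m d} → (Fin m → LinForm d) → Subset d
SolSpace f x = ∀ i → eval (f i) x ≡ 1ℚ

Poly : ∀ {m d} → (Fin m → LinForm d) → Subset d
Poly f x = SolSpace f x × (∀ j → 0ℚ ≤ x j)

AllVarsAppear : ∀ {m d} → (Fin m → LinForm d) → Set
AllVarsAppear {m} {d} f = ∀ (j : Fin d) → ∃[ i ] (f i j ≢ 0ℚ)

Consistent : ∀ {m d} → (Fin m → LinForm d) → Set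
Consistent {d = d} f = ∃[ x ] SolSpace {d = d} f x

Hyp : ∀ {d} → Fin d → Fin d → Subset d
Hyp j k x = x j ≡ x k

_⊆_ : ∀ {d} → Subset d → Subset d → Set
A ⊆ B = ∀ x → A x → B x

-- (j,k) indexes a hyperplane of 𝓗 = { h_jk ∩ s : h_jk ⊉ s }
-- (j ≢ k so that h_jk is a genuine hyperplane)
InH : ∀ {m d} → (Fin m → LinForm d) → Fin d × Fin d → Set
InH f (j , k) = j ≢ k × ¬ (SolSpace f ⊆ Hyp j k)

Flat : ∀ {m d} → (Fin m → LinForm d) → List (Fin d × Fin d) → Subset d
Flat f L x = SolSpace f x × All (λ jk → Hyp (proj₁ jk) (proj₂ jk) x) L

AffHull : ∀ {d} → Subset d → Subset d
AffHull {d} C x =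
  Σ (List (ℚ × Pt d)) λ L →
    All (λ p → C (proj₂ p)) L ×
    foldr _+_ 0ℚ (map proj₁ L) ≡ 1ℚ ×
    (∀ j → x j ≡ foldr _+_ 0ℚ (map (λ p → proj₁ p * proj₂ p j) L))

RelInt : ∀ {d} → Subset d → Subset d
RelInt C x =
  C x × (Σ ℚ λ ε → 0ℚ < ε ×
    (∀ y → AffHull C y → (∀ j → ∣ y j - x j ∣ < ε) → C y))

Transverse : ∀ {m d} → (Fin m → LinForm d) → Set
Transverse {d = d} f =
  (∀ jk → InH f jk → ¬ (Poly f ⊆ Hyp (proj₁ jk) (proj₂ jk))) ×
  (∀ (L : List (Fin d × Fin d)) → All (InH f) L →
     ∃[ x ] (Flat f L x × Poly f x) →
     ∃[ y ] (Flat f L y × RelInt (Poly f) y))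

-- The barycentre (1/c)·𝟏 of the equal-weight system lies in s and has all
-- coordinates equal to 1/c > 0, so it lies on every h_jk (hence in every flat of 𝓗)
-- and in the relative interior of P.  For the first half of transversality, the
-- map x ↦ (x + S𝟏)/(1 + cS), with S = ∑ⱼ |x_j|, carries each x ∈ s into P and
-- preserves and reflects every equation x_j = x_k; so P ⊆ h_jk forces s ⊆ h_jk.
module Submission where

open import Defs
open import Data.Nat using (ℕ; zero; suc)
open import Data.Fin using (Fin; zero; suc)
open import Data.Rational
  using (ℚ; 0ℚ; 1ℚ; _<_; _≤_; _+_; _*_; -_; _-_; ∣_∣; 1/_; NonZero; Positive; NonNegative; positive; nonNegative)
open import Data.Rational.Properties
open import Data.List using (List; []; _∷_; foldr; map)
open import Data.List.Relation.Unary.All as All using (All; []; _∷_)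
open import Data.Product using (Σ; ∃-syntax; _×_; _,_; proj₁; proj₂)
open import Data.Sum using (inj₁; inj₂)
open import Algebra.Bundles using (Ring; CommutativeMonoid)
open import Algebra.Properties.Semiring.Sum (Ring.semiring +-*-ring)
  using (sum; sum-cong-≗; ∑-distrib-+; *-distribˡ-sum)
open import Algebra.Properties.CommutativeSemigroup (CommutativeMonoid.commutativeSemigroup *-1-commutativeMonoid)
  using (x∙yz≈y∙xz)
open import Algebra.Properties.Group +-0-group using () renaming (∙-cancelˡ to +-cancelˡ-≡)
open import Relation.Binary.PropositionalEquality
  using (_≡_; _≢_; refl; sym; trans; cong; cong₂; subst; module ≡-Reasoning)
open import Relation.Nullary using (¬_)

∑≡sum : ∀ {n} (f : Fin n → ℚ) → ∑ f ≡ sum f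
∑≡sum {zero}  f = refl
∑≡sum {suc n} f = cong (f zero +_) (∑≡sum (λ i → f (suc i)))

∑-cong-≗ : ∀ {n} {u v : Fin n → ℚ} → (∀ j → u j ≡ v j) → ∑ u ≡ ∑ v
∑-cong-≗ {u = u} {v} u≗v = trans (∑≡sum u) (trans (sum-cong-≗ u≗v) (sym (∑≡sum v)))

module _ {d : ℕ} (a : LinForm d) where

  eval-cong : {x y : Pt d} → (∀ j → x j ≡ y j) → eval a x ≡ eval a y
  eval-cong x≗y = ∑-cong-≗ (λ j → cong (a j *_) (x≗y j))

  eval-+ : (x y : Pt d) → eval a (λ j → x j + y j) ≡ eval a x + eval a y
  eval-+ x y = begin
    ∑ (λ j → a j * (x j + y j))            ≡⟨ ∑≡sum {d} _ ⟩
    sum (λ j → a j * (x j + y j))          ≡⟨ sum-cong-≗ (λ j → *-distribˡ-+ (a j) (x j) (y j)) ⟩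
    sum (λ j → a j * x j + a j * y j)      ≡⟨ ∑-distrib-+ (λ j → a j * x j) (λ j → a j * y j) ⟩
    sum (λ j → a j * x j) + sum (λ j → a j * y j)
      ≡⟨ sym (cong₂ _+_ (∑≡sum (λ j → a j * x j)) (∑≡sum (λ j → a j * y j))) ⟩
    eval a x + eval a y                    ∎
    where open ≡-Reasoning

  eval-* : (r : ℚ) (x : Pt d) → eval a (λ j → r * x j) ≡ r * eval a x
  eval-* r x = begin
    ∑ (λ j → a j * (r * x j))     ≡⟨ ∑≡sum {d} _ ⟩
    sum (λ j → a j * (r * x j))   ≡⟨ sum-cong-≗ (λ j → x∙yz≈y∙xz (a j) r (x j)) ⟩
    sum (λ j → r * (a j * x j))   ≡⟨ sym (*-distribˡ-sum r (λ j → a j * x j)) ⟩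
    r * sum (λ j → a j * x j)     ≡⟨ cong (r *_) (sym (∑≡sum (λ j → a j * x j))) ⟩
    r * eval a x                  ∎
    where open ≡-Reasoning

  eval-const : (r : ℚ) → eval a (λ _ → r) ≡ r * eval a ones
  eval-const r = trans (eval-cong (λ _ → sym (*-identityʳ r))) (eval-* r ones)

  eval-0 : eval a (λ _ → 0ℚ) ≡ 0ℚ
  eval-0 = trans (eval-const 0ℚ) (*-zeroˡ (eval a ones))

affineCombination : ∀ {d} → List (ℚ × Pt d) → Pt d
affineCombination L j = foldr _+_ 0ℚ (map (λ p → proj₁ p * proj₂ p j) L)

eval-affineCombination : ∀ {d} (a : LinForm d) (L : List (ℚ × Pt d)) →
  All (λ p → eval a (proj₂ p) ≡ 1ℚ) L →
  eval a (affineCombination L) ≡ foldr _+_ 0ℚ (map proj₁ L)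
eval-affineCombination a []            []         = eval-0 a
eval-affineCombination a ((r , p) ∷ L) (ap≡1 ∷ Ls) = begin
  eval a (λ j → r * p j + affineCombination L j)     ≡⟨ eval-+ a _ (affineCombination L) ⟩
  eval a (λ j → r * p j) + eval a (affineCombination L)
    ≡⟨ cong₂ _+_ (eval-* a r p) (eval-affineCombination a L Ls) ⟩
  r * eval a p + foldr _+_ 0ℚ (map proj₁ L)
    ≡⟨ cong (λ t → r * t + foldr _+_ 0ℚ (map proj₁ L)) ap≡1 ⟩
  r * 1ℚ + foldr _+_ 0ℚ (map proj₁ L)               ≡⟨ cong (_+ foldr _+_ 0ℚ (map proj₁ L)) (*-identityʳ r) ⟩
  r + foldr _+_ 0ℚ (map proj₁ L)                    ∎
  where open ≡-Reasoning

AffHull⊆SolSpace : ∀ {m d} (f : Fin m → LinForm d) {C : Subset d} →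
  C ⊆ SolSpace f → AffHull C ⊆ SolSpace f
AffHull⊆SolSpace f C⊆s x (L , L⊆C , ∑weights≡1 , x≡comb) i =
  trans (eval-cong (f i) x≡comb)
    (trans (eval-affineCombination (f i) L (All.map (λ {p} p∈C → C⊆s (proj₂ p) p∈C i) L⊆C))
      ∑weights≡1)

0≤∣p∣+p : ∀ p → 0ℚ ≤ ∣ p ∣ + p
0≤∣p∣+p p with ∣p∣≡p∨∣p∣≡-p p
... | inj₁ ∣p∣≡p  = subst (λ t → 0ℚ ≤ t + p) (sym ∣p∣≡p) (+-mono-≤ 0≤p 0≤p)
  where 0≤p = ∣p∣≡p⇒0≤p ∣p∣≡p
... | inj₂ ∣p∣≡-p = subst (λ t → 0ℚ ≤ t + p) (sym ∣p∣≡-p) (≤-reflexive (sym (+-inverseˡ p)))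

∣p-q∣<q⇒0≤p : ∀ {p q} → ∣ p - q ∣ < q → 0ℚ ≤ p
∣p-q∣<q⇒0≤p {p} {q} ∣p-q∣<q = <⇒≤ (begin-strict
  0ℚ                 ≤⟨ 0≤∣p∣+p (p - q) ⟩
  ∣ p - q ∣ + (p - q) <⟨ +-monoˡ-< (p - q) ∣p-q∣<q ⟩
  q + (p - q)         ≡⟨ cong (q +_) (+-comm p (- q)) ⟩
  q + (- q + p)       ≡⟨ sym (+-assoc q (- q) p) ⟩
  (q - q) + p         ≡⟨ cong (_+ p) (+-inverseʳ q) ⟩
  0ℚ + p              ≡⟨ +-identityˡ p ⟩
  p                   ∎)
  where open ≤-Reasoning

*-cancelˡ-≡ : ∀ r .{{_ : NonZero r}} {p q : ℚ} → r * p ≡ r * q → p ≡ q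
*-cancelˡ-≡ r {p} {q} rp≡rq = begin
  p                ≡⟨ sym (*-identityˡ p) ⟩
  1ℚ * p           ≡⟨ cong (_* p) (sym (*-inverseˡ r)) ⟩
  (1/ r * r) * p   ≡⟨ *-assoc (1/ r) r p ⟩
  1/ r * (r * p)   ≡⟨ cong (1/ r *_) rp≡rq ⟩
  1/ r * (r * q)   ≡⟨ sym (*-assoc (1/ r) r q) ⟩
  (1/ r * r) * q   ≡⟨ cong (_* q) (*-inverseˡ r) ⟩
  1ℚ * q           ≡⟨ *-identityˡ q ⟩
  q                ∎
  where open ≡-Reasoning

EqualWeight : ∀ {m d} → (Fin m → LinForm d) → ℚ → Set
EqualWeight f c = ∀ i → eval (f i) ones ≡ c

SolSpace-normalise : ∀ {m d} (f : Fin m → LinForm d) (y : Pt d) (r : ℚ) .{{_ : NonZero r}} →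
  (∀ i → eval (f i) y ≡ r) → SolSpace f (λ j → 1/ r * y j)
SolSpace-normalise f y r fy≡r i = trans (eval-* (f i) (1/ r) y)
  (trans (cong (1/ r *_) (fy≡r i)) (*-inverseˡ r))

barycentre-SolSpace : ∀ {m d} (f : Fin m → LinForm d) (c : ℚ) .{{_ : NonZero c}} →
  EqualWeight f c → SolSpace f (λ _ → 1/ c)
barycentre-SolSpace f c wt i = trans (eval-cong (f i) (λ _ → sym (*-identityʳ (1/ c))))
  (SolSpace-normalise f ones c wt i)

RelInt-Poly : ∀ {m d} (f : Fin m → LinForm d) {x : Pt d} (ε : ℚ) → 0ℚ < ε →
  (∀ j → ε ≤ x j) → Poly f x → RelInt (Poly f) x
RelInt-Poly f ε 0<ε ε≤x x∈P = x∈P , ε , 0<ε , λ y y∈aff ∣y-x∣<ε →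
  AffHull⊆SolSpace f (λ _ → proj₁) y y∈aff ,
  λ j → ∣p-q∣<q⇒0≤p (<-≤-trans (∣y-x∣<ε j) (ε≤x j))

∥_∥₁ : ∀ {d} → Pt d → ℚ
∥ x ∥₁ = ∑ (λ j → ∣ x j ∣)

0≤∥x∥₁ : ∀ {d} (x : Pt d) → 0ℚ ≤ ∥ x ∥₁
0≤∥x∥₁ {zero}  x = ≤-refl
0≤∥x∥₁ {suc d} x = +-mono-≤ (0≤∣p∣ (x zero)) (0≤∥x∥₁ (λ i → x (suc i)))

∣xⱼ∣≤∥x∥₁ : ∀ {d} (x : Pt d) j → ∣ x j ∣ ≤ ∥ x ∥₁
∣xⱼ∣≤∥x∥₁ {suc d} x zero    = begin
  ∣ x zero ∣                          ≡⟨ sym (+-identityʳ _) ⟩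
  ∣ x zero ∣ + 0ℚ                     ≤⟨ +-monoʳ-≤ ∣ x zero ∣ (0≤∥x∥₁ (λ i → x (suc i))) ⟩
  ∣ x zero ∣ + ∥ (λ i → x (suc i)) ∥₁ ∎
  where open ≤-Reasoning
∣xⱼ∣≤∥x∥₁ {suc d} x (suc j) = begin
  ∣ x (suc j) ∣                       ≤⟨ ∣xⱼ∣≤∥x∥₁ (λ i → x (suc i)) j ⟩
  ∥ (λ i → x (suc i)) ∥₁              ≡⟨ sym (+-identityˡ _) ⟩
  0ℚ + ∥ (λ i → x (suc i)) ∥₁         ≤⟨ +-monoˡ-≤ ∥ (λ i → x (suc i)) ∥₁ (0≤∣p∣ (x zero)) ⟩
  ∣ x zero ∣ + ∥ (λ i → x (suc i)) ∥₁ ∎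
  where open ≤-Reasoning

0≤∥x∥₁+xⱼ : ∀ {d} (x : Pt d) j → 0ℚ ≤ ∥ x ∥₁ + x j
0≤∥x∥₁+xⱼ x j = ≤-trans (0≤∣p∣+p (x j)) (+-monoˡ-≤ (x j) (∣xⱼ∣≤∥x∥₁ x j))

module PushIntoOrthant {m d} (f : Fin m → LinForm d) (c : ℚ) .{{_ : NonNegative c}}
                       (wt : EqualWeight f c) (x : Pt d) (x∈s : SolSpace f x) where

  S : ℚ
  S = ∥ x ∥₁

  T : ℚ
  T = S * c + 1ℚ

  instance
    S-nonNeg : NonNegative S
    S-nonNeg = nonNegative (0≤∥x∥₁ x)
    Sc-nonNeg : NonNegative (S * c)
    Sc-nonNeg = nonNeg*nonNeg⇒nonNeg S c
    T-pos : Positive T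
    T-pos = nonNeg+pos⇒pos (S * c) 1ℚ
    T-nonZero : NonZero T
    T-nonZero = pos⇒nonZero T
    1/T-nonNeg : NonNegative (1/ T)
    1/T-nonNeg = pos⇒nonNeg (1/ T) {{1/pos⇒pos T}}
    1/T-nonZero : NonZero (1/ T)
    1/T-nonZero = nonZero⇒1/nonZero T

  push : Pt d
  push j = 1/ T * (S + x j)

  push∈P : Poly f push
  push∈P = SolSpace-normalise f (λ j → S + x j) T eval-shift , 0≤push
    where
    eval-shift : ∀ i → eval (f i) (λ j → S + x j) ≡ T
    eval-shift i = trans (eval-+ (f i) (λ _ → S) x)
      (cong₂ _+_ (trans (eval-const (f i) S) (cong (S *_) (wt i))) (x∈s i))
    0≤push : ∀ j → 0ℚ ≤ push j
    0≤push j = nonNegative⁻¹ (push j)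
      {{nonNeg*nonNeg⇒nonNeg (1/ T) (S + x j) {{nonNegative (0≤∥x∥₁+xⱼ x j)}}}}

  push-reflects-Hyp : ∀ {j k} → Hyp j k push → Hyp j k x
  push-reflects-Hyp {j} {k} pushⱼ≡pushₖ =
    +-cancelˡ-≡ S (x j) (x k) (*-cancelˡ-≡ (1/ T) pushⱼ≡pushₖ)

Poly⊆Hyp⇒SolSpace⊆Hyp : ∀ {m d} (f : Fin m → LinForm d) (c : ℚ) .{{_ : NonNegative c}} →
  EqualWeight f c → ∀ {j k} → Poly f ⊆ Hyp j k → SolSpace f ⊆ Hyp j k
Poly⊆Hyp⇒SolSpace⊆Hyp f c wt P⊆h x x∈s = push-reflects-Hyp (P⊆h push push∈P)
  where open PushIntoOrthant f c wt x x∈s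

lemma3p16 : (m d : ℕ) (f : Fin m → LinForm d) →
    AllVarsAppear f →
    Consistent f →
    (∀ (j k : Fin d) → j ≢ k → ¬ (SolSpace f ⊆ Hyp j k)) →
    (Σ ℚ λ c → 0ℚ < c × (∀ i → eval (f i) ones ≡ c)) →
    Transverse f
lemma3p16 m d f _ _ _ (c , 0<c , wt) = P⊈h , flat-meets-RelInt
  where
  instance
    c-pos : Positive c
    c-pos = positive 0<c
    c-nonNeg : NonNegative c
    c-nonNeg = pos⇒nonNeg c
    c-nonZero : NonZero c
    c-nonZero = pos⇒nonZero c

  P⊈h : ∀ jk → InH f jk → ¬ (Poly f ⊆ Hyp (proj₁ jk) (proj₂ jk))
  P⊈h _ (_ , s⊈h) P⊆h = s⊈h (Poly⊆Hyp⇒SolSpace⊆Hyp f c wt P⊆h)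

  0<1/c : 0ℚ < 1/ c
  0<1/c = positive⁻¹ (1/ c) {{1/pos⇒pos c}}

  barycentre∈P : Poly f (λ _ → 1/ c)
  barycentre∈P = barycentre-SolSpace f c wt , λ _ → <⇒≤ 0<1/c

  flat-meets-RelInt : ∀ L → All (InH f) L → ∃[ x ] (Flat f L x × Poly f x) →
                      ∃[ y ] (Flat f L y × RelInt (Poly f) y)
  flat-meets-RelInt L _ _ =
    (λ _ → 1/ c) , (proj₁ barycentre∈P , All.tabulate (λ _ → refl)) ,
    RelInt-Poly f (1/ c) 0<1/c (λ _ → ≤-refl) barycentre∈P
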